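{- Let $X$ be a finite non-empty set and $R$ a monotone transit function on $X$. If $R$ satisfies (uc) — for all $x,y,u,v\in X$, if $R(x,y)\cap R(u,v)\neq\emptyset$ then there are $p,q\in R(x,y)\cup R(u,v)$ with $R(x,y)\cup R(u,v)=R(p,q)$ — then $R$ satisfies (u): for all $u,v,z\in X$, if $z\in R(u,v)$ then $R(u,v)=R(u,z)\cup R(z,v)$.
   Context: A transit function on a finite non-empty set $X$ is a map $R:X\times X\to 2^X$ such that for all $u,v\in X$: $u\in R(u,v)$, $R(u,v)=R(v,u)$, and $R(u,u)=\{u\}$. $R$ is monotone if for all $u,v,p,q\in X$, $p,q\in R(u,v)$ implies $R(p,q)\subseteq R(u,v)$. -}

module Defs where

open import Data.Nat using (ℕ)
open import Data.Fin using (Fin)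
open import Data.Fin.Subset using (Subset; _∈_; _⊆_; _∪_; _∩_; ⁅_⁆; Nonempty)
open import Data.Product using (Σ; ∃; _×_)
open import Relation.Binary.PropositionalEquality using (_≡_)

-- A map R : X × X → 2^X on the finite set X = Fin n (subsets as Data.Fin.Subset).
-- Equality of subsets is _≡_ (Subset n = Vec Bool n, so this is extensional equality).
Interval : ℕ → Set
Interval n = Fin n → Fin n → Subset n

record IsTransit {n : ℕ} (R : Interval n) : Set where
  field
    extensive : ∀ u v → u ∈ R u v
    symmetric : ∀ u v → R u v ≡ R v u
    idempotent : ∀ u → R u u ≡ ⁅ u ⁆

Monotone : {n : ℕ} → Interval n → Set
Monotone R = ∀ u v p q → p ∈ R u v → q ∈ R u v → R p q ⊆ R u v

UC : {n : ℕ} → Interval n → Set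
UC R = ∀ x y u v → Nonempty (R x y ∩ R u v) →
  ∃ λ p → ∃ λ q → p ∈ (R x y ∪ R u v) × q ∈ (R x y ∪ R u v) × (R x y ∪ R u v ≡ R p q)

U : {n : ℕ} → Interval n → Set
U R = ∀ u v z → z ∈ R u v → R u v ≡ R u z ∪ R z v

{-# OPTIONS --safe #-}
module Submission where

-- R(u,z) ∪ R(z,v) lies in R(u,v) because R(u,v) is convex (monotonicity) and
-- contains u, z, v. Conversely R(u,z) and R(z,v) meet in z, so by (uc) their
-- union is an interval R(p,q), hence convex; it contains u and v, so R(u,v) ⊆ R(p,q).

open import Defs
open import Data.Nat using (ℕ; suc)
open import Data.Fin.Subset using (Subset; _∈_; _⊆_; _∪_)
open import Data.Fin.Subset.Properties using (⊆-antisym; x∈p∪q⁻; x∈p∪q⁺; x∈p∩q⁺)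
open import Data.Product using (_,_)
open import Data.Sum using (inj₁; inj₂)
open import Relation.Binary.PropositionalEquality using (_≡_; refl; subst)

module _ {n : ℕ} (R : Interval n) where

  Convex : Subset n → Set
  Convex A = ∀ {u v} → u ∈ A → v ∈ A → R u v ⊆ A

  Monotone⇒interval-convex : Monotone R → ∀ p q → Convex (R p q)
  Monotone⇒interval-convex mono p q = mono p q _ _

  interval-convex : ∀ {A p q} → A ≡ R p q → Monotone R → Convex A
  interval-convex {p = p} {q} refl mono = Monotone⇒interval-convex mono p q

  ∪-⊆-convex : ∀ {A u z v} → Convex A → u ∈ A → z ∈ A → v ∈ A → R u z ∪ R z v ⊆ A
  ∪-⊆-convex A-convex u∈A z∈A v∈A x∈∪ with x∈p∪q⁻ _ _ x∈∪
  ... | inj₁ x∈Ruz = A-convex u∈A z∈A x∈Ruz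
  ... | inj₂ x∈Rzv = A-convex z∈A v∈A x∈Rzv

module _ {n : ℕ} {R : Interval n} (transit : IsTransit R) where

  open IsTransit transit

  extensiveʳ : ∀ u v → v ∈ R u v
  extensiveʳ u v = subst (v ∈_) (symmetric v u) (extensive v u)

  UC⇒∪-convex : Monotone R → UC R → ∀ {u z v} → Convex R (R u z ∪ R z v)
  UC⇒∪-convex mono uc {u} {z} {v}
    with uc u z z v (z , x∈p∩q⁺ (extensiveʳ u z , extensive z v))
  ... | _ , _ , _ , _ , ∪≡Rpq = interval-convex R ∪≡Rpq mono

  subintervals-⊆ : Monotone R → ∀ {u v z} → z ∈ R u v → R u z ∪ R z v ⊆ R u v
  subintervals-⊆ mono {u} {v} z∈Ruv =
    ∪-⊆-convex R (Monotone⇒interval-convex R mono u v) (extensive u v) z∈Ruv (extensiveʳ u v)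

  ⊆-subintervals : Monotone R → UC R → ∀ {u v z} → R u v ⊆ R u z ∪ R z v
  ⊆-subintervals mono uc {u} {v} {z} =
    UC⇒∪-convex mono uc (x∈p∪q⁺ (inj₁ (extensive u z))) (x∈p∪q⁺ (inj₂ (extensiveʳ z v)))

lemma7 : (m : ℕ) (R : Interval (suc m)) → IsTransit R → Monotone R → UC R → U R
lemma7 m R transit mono uc u v z z∈Ruv =
  ⊆-antisym (⊆-subintervals transit mono uc) (subintervals-⊆ transit mono z∈Ruv)
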